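{- Fix an integer $k\ge 2$. Let $H$ be a $k$-uniform hypergraph whose vertex set is partitioned into parts each of size $\ell$, such that for every part the sum of the degrees of its vertices is at most $\Delta$. If $\ell^k\ge e\,(k(\Delta-1)+1)$, then $H$ has an independent transversal.
   Context: The degree of a vertex in a hypergraph is the number of edges containing it. Given a partition of the vertex set, a transversal is a set of vertices containing exactly one vertex from each part; it is independent if it contains no edge of $H$. $e$ is Euler's number. -}

module Defs where

open import Data.Nat using (ℕ; zero; suc; _+_; _*_; _^_; _≤_; _!)
open import Data.Fin using (Fin)
open import Data.Fin.Properties using () renaming (_≟_ to _≟ᶠ_)
open import Data.Product using (_×_; _,_; proj₁; proj₂)
open import Data.Product.Properties using (≡-dec)
open import Data.List using (List; length; filter; allFin)
open import Data.Nat.ListAction using (sum)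
open import Data.List.Relation.Unary.All using (All)
open import Data.List.Relation.Unary.AllPairs using (AllPairs)
open import Data.List.Relation.Unary.Unique.Propositional using (Unique)
open import Data.List.Relation.Binary.Permutation.Propositional using (_↭_)
open import Data.List.Relation.Unary.Any using (any?)
open import Relation.Binary.PropositionalEquality using (_≡_)
open import Relation.Nullary using (¬_; Dec)
import Data.List as L

-- Vertex set: m parts, each of size ℓ; vertex (i , j) is the j-th vertex of part i.
Vertex : ℕ → ℕ → Set
Vertex m ℓ = Fin m × Fin ℓ

_≟ᵥ_ : ∀ {m ℓ} (u v : Vertex m ℓ) → Dec (u ≡ v)
_≟ᵥ_ = ≡-dec _≟ᶠ_ _≟ᶠ_

Hypergraph : ℕ → ℕ → Set
Hypergraph m ℓ = List (List (Vertex m ℓ))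

IsUniform : ∀ {m ℓ} → ℕ → Hypergraph m ℓ → Set
IsUniform {m} {ℓ} k H =
  All (λ e → Unique e × length e ≡ k) H × AllPairs (λ e f → ¬ (e ↭ f)) H

degree : ∀ {m ℓ} → Hypergraph m ℓ → Vertex m ℓ → ℕ
degree H v = length (filter (λ e → any? (v ≟ᵥ_) e) H)

partDegree : ∀ {m ℓ} → Hypergraph m ℓ → Fin m → ℕ
partDegree {m} {ℓ} H i = sum (L.map (λ j → degree H (i , j)) (allFin ℓ))

-- A transversal picks exactly one vertex (i , t i) from each part i.
Transversal : ℕ → ℕ → Set
Transversal m ℓ = Fin m → Fin ℓ

InTransversal : ∀ {m ℓ} → Transversal m ℓ → Vertex m ℓ → Set
InTransversal t v = t (proj₁ v) ≡ proj₂ v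

Independent : ∀ {m ℓ} → Hypergraph m ℓ → Transversal m ℓ → Set
Independent H t = All (λ e → ¬ All (InTransversal t) e) H

-- eNum n = Σ_{i=0}^{n} n!/i!, so eNum n / n! is the n-th partial sum of
-- e = Σ 1/i!.  (eNum 0 = 1, eNum (n+1) = (n+1)·eNum n + 1.)
eNum : ℕ → ℕ
eNum zero = 1
eNum (suc n) = suc n * eNum n + 1

-- "x ≥ e · (k(Δ-1)+1)" for natural x, with e = sup of its partial sums:
-- for all n,  x · n! ≥ (kΔ + 1 - k) · eNum n, written without subtraction
-- (the factor k(Δ-1)+1 may be negative when Δ = 0).
GeqETimes : (x k Δ : ℕ) → Set
GeqETimes x k Δ = ∀ n → (k * Δ + 1) * eNum n ≤ x * (n !) + k * eNum n

module Submission where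

-- Proof by a counting version of the symmetric Lovász Local Lemma.
--
-- A transversal is an assignment v : Vec (Fin ℓ) m of a vertex to every part;
-- each edge e is the event "v contains every vertex of e", of probability ℓ^(-k)
-- (count-hit).  An edge is independent of all edges that meet none of its parts,
-- and the part-degree bound leaves at most d = k(Δ - 1) edges meeting its parts
-- (Degrees.neighbours-bound).  With c = d + 1, the hypothesis ℓ^k ≥ e(d + 1)
-- gives the local condition (c + 1)^(r + 1) ≤ ℓ^k cʳ for r ≤ d, using
-- (1 + 1/n)ⁿ ≤ ∑_{i ≤ n} 1/i! (local-condition).  The local lemma is then proved
-- by counting: for every set M of edges and edge q, at most a 1/(c + 1) fraction
-- of the transversals avoiding M contain E q (LocalLemma.bounded-step, by
-- induction on |M|), so at least (c/(c + 1))^|H| ℓ^m transversals avoid every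
-- edge.

open import Defs
open import Data.Nat using (ℕ; _^_; _≤_)
open import Data.Product using (Σ)

open import Data.Nat using (zero; suc; _+_; _*_; _∸_; _<_; z≤n; s≤s; NonZero; >-nonZero; _!; +-*-rawSemiring)
open import Data.Nat.Properties hiding (_≟_)
open import Data.Nat.Combinatorics using (_C_; nCk+nC[k+1]≡[n+1]C[k+1])
open import Data.Nat.Tactic.RingSolver using (solve-∀)
open import Data.Nat.ListAction using () renaming (sum to ListSum)
open import Data.Bool using (Bool; true; false; _∧_; _∨_; not; if_then_else_)
open import Data.Bool.Properties using (∨-conicalˡ; ∨-conicalʳ; ∨-zeroʳ; ∧-identityʳ; ∧-zeroʳ; ∧-distribʳ-∨)
open import Data.Fin using (Fin; zero; suc; toℕ; fromℕ; fromℕ<; inject₁)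
open import Data.Fin.Properties using (_≟_; toℕ≤pred[n]; toℕ-inject₁; toℕ-fromℕ)
open import Data.Vec using (Vec; []; _∷_; lookup; _[_]≔_)
open import Data.Vec.Properties using (lookup∘update′)
open import Data.List using (List; []; _∷_; length; filter; allFin; tabulate)
import Data.List as L
open import Data.List.Properties using (map-tabulate)
open import Data.List.Membership.Propositional using (_∈_; lose)
open import Data.List.Membership.Propositional.Properties using (∈-lookup)
open import Data.List.Relation.Unary.Any using (here; there; any?)
import Data.List.Relation.Unary.Any as Any
open import Data.List.Relation.Unary.Any.Properties using (lookup-index)
open import Data.List.Relation.Unary.All using (All; []; _∷_)
import Data.List.Relation.Unary.All as All
open import Data.List.Relation.Unary.AllPairs using (_∷_)
open import Data.List.Relation.Unary.Unique.Propositional using (Unique)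
open import Data.Product using (_,_; _×_; proj₁; proj₂)
open import Data.Empty using (⊥; ⊥-elim)
open import Relation.Nullary using (¬_; Dec; yes; no; does)
open import Relation.Nullary.Decidable using (dec-true)
open import Relation.Binary.PropositionalEquality
open import Algebra.Properties.Semiring.Sum +-*-semiring
  using (sum; sum-syntax; sum-cong-≗; ∑-distrib-+; ∑-comm; *-distribˡ-sum; *-distribʳ-sum; sum-init-last)
open import Algebra.Properties.CommutativeMonoid.Sum *-1-commutativeMonoid
  using () renaming (sum to ∏; sum-cong-≗ to ∏-cong; ∑-distrib-+ to ∏-distrib-*; sum-replicate-zero to ∏-replicate-one)
import Algebra.Properties.CommutativeSemiring.Binomial +-*-commutativeSemiring as Binomial
import Algebra.Definitions.RawSemiring +-*-rawSemiring as Semiring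

𝟙 : Bool → ℕ
𝟙 true = 1
𝟙 false = 0

𝟙≤1 : ∀ b → 𝟙 b ≤ 1
𝟙≤1 true = ≤-refl
𝟙≤1 false = z≤n

infix 4 _==_
_==_ : ∀ {n} → Fin n → Fin n → Bool
i == j = does (i ≟ j)

==-refl : ∀ {n} (i : Fin n) → (i == i) ≡ true
==-refl zero = refl
==-refl (suc i) = ==-refl i

𝟙-distinct : ∀ {n} (a : Fin n) {j j′} → ¬ j ≡ j′ → 𝟙 (a == j) * 𝟙 (a == j′) ≡ 0
𝟙-distinct a {j} {j′} j≢j′ with a ≟ j | a ≟ j′
... | yes a≡j | yes a≡j′ = ⊥-elim (j≢j′ (trans (sym a≡j) a≡j′))
... | yes _ | no _ = refl
... | no _ | _ = refl

∑-mono : ∀ {n} {f g : Fin n → ℕ} → (∀ i → f i ≤ g i) → sum f ≤ sum g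
∑-mono {zero} f≤g = z≤n
∑-mono {suc n} f≤g = +-mono-≤ (f≤g zero) (∑-mono (λ i → f≤g (suc i)))

∑-const : ∀ n a → ∑[ i < n ] a ≡ n * a
∑-const zero a = refl
∑-const (suc n) a = cong (a +_) (∑-const n a)

∑-zero : ∀ n → ∑[ i < n ] 0 ≡ 0
∑-zero n = trans (∑-const n 0) (*-zeroʳ n)

term≤∑ : ∀ {n} (f : Fin n → ℕ) i → f i ≤ sum f
term≤∑ f zero = m≤m+n _ _
term≤∑ f (suc i) = ≤-trans (term≤∑ (λ j → f (suc j)) i) (m≤n+m _ _)

∑-pos : ∀ {n} (f : Fin n → ℕ) → 0 < sum f → Σ (Fin n) λ i → 0 < f i
∑-pos {suc n} f 0<∑ with f zero in eq
... | suc _ = zero , subst (0 <_) (sym eq) (s≤s z≤n)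
... | zero with ∑-pos (λ i → f (suc i)) 0<∑
...   | i , 0<fi = suc i , 0<fi

∑-pick : ∀ {n} (q : Fin n) (f : Fin n → ℕ) → ∑[ i < n ] (𝟙 (i == q) * f i) ≡ f q
∑-pick {suc n} zero f = begin
    1 * f zero + ∑[ i < n ] (0 * f (suc i))
  ≡⟨ cong₂ _+_ (*-identityˡ (f zero)) (∑-zero n) ⟩
    f zero + 0
  ≡⟨ +-identityʳ (f zero) ⟩
    f zero
  ∎
  where open ≡-Reasoning
∑-pick (suc q) f = ∑-pick q (λ i → f (suc i))

positive-factors : ∀ a b → 0 < a * b → 0 < a × 0 < b
positive-factors (suc a) (suc b) _ = s≤s z≤n , s≤s z≤n
positive-factors (suc a) zero 0<a*0 = ⊥-elim (<-irrefl (sym (*-zeroʳ (suc a))) 0<a*0)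

∏≤1 : ∀ {n} (f : Fin n → ℕ) → (∀ i → f i ≤ 1) → ∏ f ≤ 1
∏≤1 {zero} f f≤1 = ≤-refl
∏≤1 {suc n} f f≤1 = *-mono-≤ (f≤1 zero) (∏≤1 (λ i → f (suc i)) (λ i → f≤1 (suc i)))

∏-pos : ∀ {n} (f : Fin n → ℕ) → 0 < ∏ f → ∀ i → 0 < f i
∏-pos f 0<∏ zero = proj₁ (positive-factors (f zero) _ 0<∏)
∏-pos f 0<∏ (suc i) = ∏-pos (λ j → f (suc j)) (proj₂ (positive-factors (f zero) _ 0<∏)) i

∏-ones : ∀ {n} (f : Fin n → ℕ) → (∀ i → f i ≡ 1) → ∏ f ≡ 1
∏-ones {n} f f≡1 = trans (∏-cong {n} f≡1) (∏-replicate-one n)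

∏-pick : ∀ {n} q a (f : Fin n → ℕ) → (∀ i → f i ≡ (if i == q then a else 1)) → ∏ f ≡ a
∏-pick zero a f f≡ = trans (cong₂ _*_ (f≡ zero) (∏-ones (λ i → f (suc i)) (λ i → f≡ (suc i)))) (*-identityʳ a)
∏-pick (suc q) a f f≡ = trans (cong₂ _*_ (f≡ zero) (∏-pick q a (λ i → f (suc i)) (λ i → f≡ (suc i)))) (*-identityˡ a)

-- Sets of events are boolean masks M : Fin n → Bool, with cardinality # M.

Mask : ℕ → Set
Mask n = Fin n → Bool

# : ∀ {n} → Mask n → ℕ
# M = sum (λ i → 𝟙 (M i))

infixl 6 _∪_ _∖_ _─_
infixl 7 _∩_
infix 4 _⊆_

_∪_ _∩_ _∖_ : ∀ {n} → Mask n → Mask n → Mask n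
(M ∪ P) i = M i ∨ P i
(M ∩ P) i = M i ∧ P i
(M ∖ P) i = M i ∧ not (P i)

_─_ : ∀ {n} → Mask n → Fin n → Mask n
M ─ q = M ∖ (_== q)

_⊆_ : ∀ {n} → Mask n → Mask n → Set
M ⊆ M′ = ∀ i → M i ≡ true → M′ i ≡ true

∧-true : ∀ a b → a ∧ b ≡ true → a ≡ true × b ≡ true
∧-true true true _ = refl , refl

∩-⊆ : ∀ {n} (M P : Mask n) → M ∩ P ⊆ M
∩-⊆ M P i in-both = proj₁ (∧-true (M i) (P i) in-both)

─-⊆ : ∀ {n} {A M : Mask n} q → A ⊆ M → A ─ q ⊆ M ─ q
─-⊆ {A = A} q A⊆M j in-A─q = let (in-A , j≢q) = ∧-true (A j) _ in-A─q in cong₂ _∧_ (A⊆M j in-A) j≢q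

∖-─ : ∀ {n} (M A : Mask n) q → A q ≡ true → ∀ j → (M ∖ A) j ≡ ((M ─ q) ∖ (A ─ q)) j
∖-─ M A q Aq j with j ≟ q
... | yes refl rewrite Aq | ∧-zeroʳ (M q) = refl
... | no _ rewrite ∧-identityʳ (M j) | ∧-identityʳ (A j) = refl

∖-∩ : ∀ {n} (M P : Mask n) j → (M ∖ (M ∩ P)) j ≡ (M ∖ P) j
∖-∩ M P j with M j
... | true = refl
... | false = refl

#-cong : ∀ {n} {M M′ : Mask n} → (∀ i → M i ≡ M′ i) → # M ≡ # M′
#-cong M≡M′ = sum-cong-≗ (λ i → cong 𝟙 (M≡M′ i))

#-mono : ∀ {n} {M M′ : Mask n} → M ⊆ M′ → # M ≤ # M′
#-mono {M = M} {M′} M⊆M′ = ∑-mono included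
  where
  included : ∀ i → 𝟙 (M i) ≤ 𝟙 (M′ i)
  included i with M i in Mi
  ... | false = z≤n
  ... | true rewrite M⊆M′ i Mi = ≤-refl

#-union : ∀ {n} (M P : Mask n) → # (M ∪ P) ≤ # M + # P
#-union M P = ≤-trans (∑-mono (λ i → 𝟙-∨ (M i) (P i))) (≤-reflexive (∑-distrib-+ (λ i → 𝟙 (M i)) (λ i → 𝟙 (P i))))
  where
  𝟙-∨ : ∀ a b → 𝟙 (a ∨ b) ≤ 𝟙 a + 𝟙 b
  𝟙-∨ true b = s≤s z≤n
  𝟙-∨ false b = ≤-refl

#-remove : ∀ {n} (M : Mask n) q → M q ≡ true → # M ≡ suc (# (M ─ q))
#-remove {suc n} M zero Mq rewrite Mq =
  cong suc (sum-cong-≗ {n} (λ i → cong 𝟙 (sym (∧-identityʳ (M (suc i))))))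
#-remove {suc n} M (suc q) Mq =
  trans (cong (𝟙 (M zero) +_) (#-remove (λ i → M (suc i)) q Mq))
        (trans (+-suc (𝟙 (M zero)) _) (cong (λ b → suc (𝟙 b + # ((λ i → M (suc i)) ─ q))) (sym (∧-identityʳ (M zero)))))

#-witness : ∀ {n} (M : Mask n) → 0 < # M → Σ (Fin n) λ i → M i ≡ true
#-witness M 0<#M with ∑-pos (λ i → 𝟙 (M i)) 0<#M
... | i , 0<𝟙 = i , 𝟙-pos (M i) 0<𝟙
  where
  𝟙-pos : ∀ b → 0 < 𝟙 b → b ≡ true
  𝟙-pos true _ = refl

#-empty : ∀ {n} (M : Mask n) → # M ≡ 0 → ∀ i → M i ≡ false
#-empty M #M≡0 i with M i in Mi
... | false = refl
... | true = ⊥-elim (n≮0 (≤-trans (≤-trans (≤-reflexive (cong 𝟙 (sym Mi))) (term≤∑ (λ j → 𝟙 (M j)) i))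
                                 (≤-reflexive #M≡0)))

length-filter≡# : ∀ {A : Set} {P : A → Set} (P? : ∀ x → Dec (P x)) (xs : List A) →
                  length (filter P? xs) ≡ # (λ i → does (P? (L.lookup xs i)))
length-filter≡# P? [] = refl
length-filter≡# P? (x ∷ xs) with does (P? x)
... | true = cong suc (length-filter≡# P? xs)
... | false = length-filter≡# P? xs

sum-allFin : ∀ n (f : Fin n → ℕ) → ListSum (L.map f (allFin n)) ≡ ∑[ i < n ] f i
sum-allFin n f = trans (cong ListSum (map-tabulate (λ i → i) f)) (sum-tabulate n f)
  where
  sum-tabulate : ∀ n (f : Fin n → ℕ) → ListSum (tabulate f) ≡ ∑[ i < n ] f i
  sum-tabulate zero f = refl
  sum-tabulate (suc n) f = cong (f zero +_) (sum-tabulate n (λ i → f (suc i)))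

all-by-index : ∀ {A : Set} {P : A → Set} (xs : List A) → (∀ i → P (L.lookup xs i)) → All P xs
all-by-index {P = P} xs P-at = All.tabulate (λ x∈xs → subst P (sym (lookup-index x∈xs)) (P-at (Any.index x∈xs)))

module Counting (ℓ : ℕ) where

  count : ∀ {n} → (Vec (Fin ℓ) n → ℕ) → ℕ
  count {zero} f = f []
  count {suc n} f = ∑[ c < ℓ ] count (λ w → f (c ∷ w))

  count-cong : ∀ {n} {f g : Vec (Fin ℓ) n → ℕ} → (∀ v → f v ≡ g v) → count f ≡ count g
  count-cong {zero} f≡g = f≡g []
  count-cong {suc n} f≡g = sum-cong-≗ (λ c → count-cong (λ w → f≡g (c ∷ w)))

  count-mono : ∀ {n} {f g : Vec (Fin ℓ) n → ℕ} → (∀ v → f v ≤ g v) → count f ≤ count g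
  count-mono {zero} f≤g = f≤g []
  count-mono {suc n} f≤g = ∑-mono (λ c → count-mono (λ w → f≤g (c ∷ w)))

  count-+ : ∀ {n} (f g : Vec (Fin ℓ) n → ℕ) → count (λ v → f v + g v) ≡ count f + count g
  count-+ {zero} f g = refl
  count-+ {suc n} f g = trans (sum-cong-≗ (λ c → count-+ (λ w → f (c ∷ w)) (λ w → g (c ∷ w))))
                              (∑-distrib-+ (λ c → count (λ w → f (c ∷ w))) (λ c → count (λ w → g (c ∷ w))))

  count-*ˡ : ∀ {n} a (f : Vec (Fin ℓ) n → ℕ) → count (λ v → a * f v) ≡ a * count f
  count-*ˡ {zero} a f = refl
  count-*ˡ {suc n} a f = trans (sum-cong-≗ (λ c → count-*ˡ a (λ w → f (c ∷ w))))
                               (sym (*-distribˡ-sum a (λ c → count (λ w → f (c ∷ w)))))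

  count-zero : ∀ {n} (f : Vec (Fin ℓ) n → ℕ) → (∀ v → f v ≡ 0) → count f ≡ 0
  count-zero f f≡0 = trans (count-cong (λ v → trans (f≡0 v) (sym (*-zeroˡ (f v))))) (count-*ˡ 0 f)

  count-pos : ∀ {n} (f : Vec (Fin ℓ) n → ℕ) → 0 < count f → Σ (Vec (Fin ℓ) n) λ v → 0 < f v
  count-pos {zero} f 0<f = [] , 0<f
  count-pos {suc n} f 0<count with ∑-pos _ 0<count
  ... | c , 0<countᶜ with count-pos (λ w → f (c ∷ w)) 0<countᶜ
  ...   | w , 0<f = c ∷ w , 0<f

  count-one-pos : ∀ {n} → 1 ≤ ℓ → 0 < count {n} (λ _ → 1)
  count-one-pos {zero} _ = s≤s z≤n
  count-one-pos {suc n} (s≤s z≤n) = ≤-trans (count-one-pos {n} (s≤s z≤n)) (term≤∑ {ℓ} (λ _ → count {n} (λ _ → 1)) zero)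

  IndependentOf : ∀ {n} → (Vec (Fin ℓ) n → ℕ) → Fin n → Set
  IndependentOf f i = ∀ v x → f (v [ i ]≔ x) ≡ f v

  count-fix : ∀ {n} (f : Vec (Fin ℓ) n → ℕ) i c → IndependentOf f i →
              ℓ * count (λ v → 𝟙 (lookup v i == c) * f v) ≡ count f
  count-fix {suc n} f zero c indep = begin
      ℓ * ∑[ c′ < ℓ ] count (λ w → 𝟙 (c′ == c) * f (c′ ∷ w))
    ≡⟨ cong (ℓ *_) (sum-cong-≗ (λ c′ → count-*ˡ (𝟙 (c′ == c)) (λ w → f (c′ ∷ w)))) ⟩
      ℓ * ∑[ c′ < ℓ ] (𝟙 (c′ == c) * count (λ w → f (c′ ∷ w)))
    ≡⟨ cong (ℓ *_) (∑-pick c (λ c′ → count (λ w → f (c′ ∷ w)))) ⟩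
      ℓ * count (λ w → f (c ∷ w))
    ≡⟨ sym (∑-const ℓ (count (λ w → f (c ∷ w)))) ⟩
      ∑[ c′ < ℓ ] count (λ w → f (c ∷ w))
    ≡⟨ sum-cong-≗ (λ c′ → count-cong (λ w → sym (indep (c ∷ w) c′))) ⟩
      ∑[ c′ < ℓ ] count (λ w → f (c′ ∷ w))
    ∎
    where open ≡-Reasoning
  count-fix {suc n} f (suc i) c indep = begin
      ℓ * ∑[ c′ < ℓ ] count (λ w → 𝟙 (lookup w i == c) * f (c′ ∷ w))
    ≡⟨ *-distribˡ-sum ℓ (λ c′ → count (λ w → 𝟙 (lookup w i == c) * f (c′ ∷ w))) ⟩
      ∑[ c′ < ℓ ] (ℓ * count (λ w → 𝟙 (lookup w i == c) * f (c′ ∷ w)))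
    ≡⟨ sum-cong-≗ (λ c′ → count-fix (λ w → f (c′ ∷ w)) i c (λ w x → indep (c′ ∷ w) x)) ⟩
      ∑[ c′ < ℓ ] count (λ w → f (c′ ∷ w))
    ∎
    where open ≡-Reasoning

module Events (m ℓ : ℕ) where
  open Counting ℓ

  hit : List (Vertex m ℓ) → Vec (Fin ℓ) m → ℕ
  hit [] v = 1
  hit ((p , j) ∷ e) v = 𝟙 (lookup v p == j) * hit e v

  hit≤1 : ∀ e v → hit e v ≤ 1
  hit≤1 [] v = ≤-refl
  hit≤1 ((p , j) ∷ e) v = *-mono-≤ (𝟙≤1 (lookup v p == j)) (hit≤1 e v)

  hit-∈ : ∀ {e x} → x ∈ e → ∀ v → hit e v ≤ 𝟙 (lookup v (proj₁ x) == proj₂ x)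
  hit-∈ {(p , j) ∷ e} (here refl) v =
    ≤-trans (*-monoʳ-≤ (𝟙 (lookup v p == j)) (hit≤1 e v)) (≤-reflexive (*-identityʳ _))
  hit-∈ {(p , j) ∷ e} (there x∈e) v =
    ≤-trans (*-monoˡ-≤ (hit e v) (𝟙≤1 (lookup v p == j))) (≤-trans (≤-reflexive (+-identityʳ _)) (hit-∈ x∈e v))

  hit-contains : ∀ e v → All (λ x → lookup v (proj₁ x) ≡ proj₂ x) e → hit e v ≡ 1
  hit-contains [] v [] = refl
  hit-contains ((p , _) ∷ e) v (refl ∷ e⊆v) rewrite ==-refl (lookup v p) =
    trans (+-identityʳ _) (hit-contains e v e⊆v)

  touches : List (Vertex m ℓ) → Fin m → Bool
  touches [] p = false
  touches ((p′ , _) ∷ e) p = (p′ == p) ∨ touches e p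

  touches-∈ : ∀ {e x} → x ∈ e → touches e (proj₁ x) ≡ true
  touches-∈ {(p , _) ∷ e} (here refl) rewrite ==-refl p = refl
  touches-∈ {(p , _) ∷ e} (there x∈e) rewrite touches-∈ x∈e = ∨-zeroʳ (p == _)

  touches-true : ∀ e p → touches e p ≡ true → Σ (Vertex m ℓ) λ y → y ∈ e × proj₁ y ≡ p
  touches-true ((p′ , j) ∷ e) p t with p′ ≟ p
  ... | yes p′≡p = (p′ , j) , here refl , p′≡p
  ... | no _ with touches-true e p t
  ...   | y , y∈e , y∈p = y , there y∈e , y∈p

  touches-false : ∀ e p → touches e p ≡ false → ∀ y → y ∈ e → ¬ proj₁ y ≡ p
  touches-false ((p , _) ∷ e) .p t _ (here refl) refl rewrite ==-refl p with t
  ... | ()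
  touches-false ((p′ , _) ∷ e) p t y (there y∈e) = touches-false e p (∨-conicalʳ _ _ t) y y∈e

  hit-independent : ∀ e p → touches e p ≡ false → IndependentOf (hit e) p
  hit-independent [] p _ v y = refl
  hit-independent ((p′ , j) ∷ e) p t v y =
    cong₂ _*_ (cong (λ a → 𝟙 (a == j)) (lookup∘update′ (touches-false ((p′ , j) ∷ e) p t (p′ , j) (here refl)) v y))
              (hit-independent e p (∨-conicalʳ _ _ t) v y)

  shares : List (Vertex m ℓ) → List (Vertex m ℓ) → Bool
  shares f [] = false
  shares f ((p , _) ∷ e) = touches f p ∨ shares f e

  shares-false : ∀ f e → shares f e ≡ false → ∀ x → x ∈ e → touches f (proj₁ x) ≡ false
  shares-false f ((p , _) ∷ e) s x (here refl) = ∨-conicalˡ _ _ s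
  shares-false f ((p , _) ∷ e) s x (there x∈e) = shares-false f e (∨-conicalʳ _ _ s) x x∈e

  neighbours : ∀ {h} → (Fin h → List (Vertex m ℓ)) → Fin h → Mask h
  neighbours E q = (λ i → shares (E i) (E q)) ─ q

  hit-clash : ∀ {p j j′} e → ¬ j ≡ j′ → (p , j′) ∈ e → ∀ v → hit ((p , j) ∷ e) v ≡ 0
  hit-clash {p} {j} {j′} e j≢j′ pj′∈e v = n≤0⇒n≡0 (begin
      𝟙 (lookup v p == j) * hit e v
    ≤⟨ *-monoʳ-≤ (𝟙 (lookup v p == j)) (hit-∈ pj′∈e v) ⟩
      𝟙 (lookup v p == j) * 𝟙 (lookup v p == j′)
    ≡⟨ 𝟙-distinct (lookup v p) j≢j′ ⟩
      0
    ∎)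
    where open ≤-Reasoning

  count-hit : ∀ e → Unique e → ∀ F → (∀ x → x ∈ e → IndependentOf F (proj₁ x)) →
              ℓ ^ length e * count (λ v → hit e v * F v) ≤ count F
  count-hit [] _ F _ = ≤-reflexive (trans (*-identityˡ _) (count-cong (λ v → +-identityʳ (F v))))
  count-hit ((p , j) ∷ e) (pj∉e ∷ e-unique) F F-indep with touches e p in t
  ... | true with touches-true e p t
  ...   | (.p , j′) , pj′∈e , refl = ≤-trans (≤-reflexive never) z≤n
    where
    j≢j′ : ¬ j ≡ j′
    j≢j′ j≡j′ = All.lookup pj∉e pj′∈e (cong (p ,_) j≡j′)
    never : ℓ ^ suc (length e) * count (λ v → hit ((p , j) ∷ e) v * F v) ≡ 0
    never = trans (cong (ℓ ^ suc (length e) *_)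
                        (count-zero _ (λ v → cong (_* F v) (hit-clash e j≢j′ pj′∈e v))))
                  (*-zeroʳ (ℓ ^ suc (length e)))
  count-hit ((p , j) ∷ e) (pj∉e ∷ e-unique) F F-indep | false = begin
      ℓ * ℓ ^ length e * count (λ v → 𝟙 (lookup v p == j) * hit e v * F v)
    ≡⟨ cong₂ _*_ (*-comm ℓ (ℓ ^ length e)) (count-cong (λ v → *-assoc (𝟙 (lookup v p == j)) (hit e v) (F v))) ⟩
      ℓ ^ length e * ℓ * count (λ v → 𝟙 (lookup v p == j) * (hit e v * F v))
    ≡⟨ *-assoc (ℓ ^ length e) ℓ _ ⟩
      ℓ ^ length e * (ℓ * count (λ v → 𝟙 (lookup v p == j) * (hit e v * F v)))
    ≡⟨ cong (ℓ ^ length e *_) (count-fix (λ v → hit e v * F v) p j rest-indep) ⟩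
      ℓ ^ length e * count (λ v → hit e v * F v)
    ≤⟨ count-hit e e-unique F (λ x x∈e → F-indep x (there x∈e)) ⟩
      count F
    ∎
    where
    open ≤-Reasoning
    rest-indep : IndependentOf (λ v → hit e v * F v) p
    rest-indep v y = cong₂ _*_ (hit-independent e p t v y) (F-indep (p , j) (here refl) v y)

×≡* : ∀ n x → n Semiring.× x ≡ n * x
×≡* zero x = refl
×≡* (suc n) x = cong (x +_) (×≡* n x)

^≡^ : ∀ x n → x Semiring.^ n ≡ x ^ n
^≡^ x zero = refl
^≡^ x (suc n) = cong (x *_) (^≡^ x n)

binomial-expansion : ∀ n → suc n ^ n ≡ ∑[ i < suc n ] ((n C toℕ i) * n ^ (n ∸ toℕ i))
binomial-expansion n = begin
    suc n ^ n
  ≡⟨ sym (^≡^ (1 + n) n) ⟩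
    (1 + n) Semiring.^ n
  ≡⟨ Binomial.theorem n 1 n ⟩
    ∑[ i < suc n ] ((n C toℕ i) Semiring.× (1 Semiring.^ toℕ i * n Semiring.^ (n ∸ toℕ i)))
  ≡⟨ sum-cong-≗ {suc n} term ⟩
    ∑[ i < suc n ] ((n C toℕ i) * n ^ (n ∸ toℕ i))
  ∎
  where
  open ≡-Reasoning
  term : ∀ i → (n C toℕ i) Semiring.× (1 Semiring.^ toℕ i * n Semiring.^ (n ∸ toℕ i)) ≡ (n C toℕ i) * n ^ (n ∸ toℕ i)
  term i = trans (×≡* (n C toℕ i) _)
                 (cong ((n C toℕ i) *_) (trans (cong₂ _*_ (trans (^≡^ 1 (toℕ i)) (^-zeroˡ (toℕ i))) (^≡^ n (n ∸ toℕ i)))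
                                               (*-identityˡ (n ^ (n ∸ toℕ i)))))

bernoulli : ∀ n i → suc i * n ^ i + n ^ suc i ≤ suc n ^ suc i
bernoulli n zero = ≤-reflexive (base n)
  where
  base : ∀ n → 1 * 1 + n * 1 ≡ suc n * 1
  base = solve-∀
bernoulli n (suc i) = begin
    suc (suc i) * n ^ suc i + n ^ suc (suc i)
  ≡⟨ regroup n i (n ^ i) ⟩
    n ^ suc i + n * (suc i * n ^ i + n ^ suc i)
  ≤⟨ +-monoˡ-≤ _ (m≤n+m (n ^ suc i) (suc i * n ^ i)) ⟩
    suc n * (suc i * n ^ i + n ^ suc i)
  ≤⟨ *-monoʳ-≤ (suc n) (bernoulli n i) ⟩
    suc n ^ suc (suc i)
  ∎
  where
  open ≤-Reasoning
  regroup : ∀ n i P → suc (suc i) * (n * P) + n * (n * P) ≡ n * P + n * (suc i * P + n * P)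
  regroup = solve-∀

-- C(n, i) · i! ≤ nⁱ, by Pascal's rule and the Bernoulli inequality.
C*!≤^ : ∀ n i → (n C i) * i ! ≤ n ^ i
C*!≤^ n zero = ≤-refl
C*!≤^ zero (suc i) = z≤n
C*!≤^ (suc n) (suc i) = begin
    (suc n C suc i) * (suc i * i !)
  ≡⟨ cong (_* (suc i * i !)) (sym (nCk+nC[k+1]≡[n+1]C[k+1] n i)) ⟩
    ((n C i) + (n C suc i)) * (suc i * i !)
  ≡⟨ regroup (n C i) (n C suc i) i (i !) ⟩
    suc i * ((n C i) * i !) + (n C suc i) * (suc i * i !)
  ≤⟨ +-mono-≤ (*-monoʳ-≤ (suc i) (C*!≤^ n i)) (C*!≤^ n (suc i)) ⟩
    suc i * n ^ i + n ^ suc i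
  ≤⟨ bernoulli n i ⟩
    suc n ^ suc i
  ∎
  where
  open ≤-Reasoning
  regroup : ∀ a b i f → (a + b) * (suc i * f) ≡ suc i * (a * f) + b * (suc i * f)
  regroup = solve-∀

-- ascending i j = (i + 1)(i + 2) ⋯ (i + j), the quotient (i + j)! / i!.
ascending : ℕ → ℕ → ℕ
ascending i zero = 1
ascending i (suc j) = suc (i + j) * ascending i j

ascending-! : ∀ i j → ascending i j * i ! ≡ (i + j) !
ascending-! i zero = trans (*-identityˡ (i !)) (cong _! (sym (+-identityʳ i)))
ascending-! i (suc j) = begin
    suc (i + j) * ascending i j * i !
  ≡⟨ *-assoc (suc (i + j)) (ascending i j) (i !) ⟩
    suc (i + j) * (ascending i j * i !)
  ≡⟨ cong (suc (i + j) *_) (ascending-! i j) ⟩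
    suc (i + j) !
  ≡⟨ cong _! (sym (+-suc i j)) ⟩
    (i + suc j) !
  ∎
  where open ≡-Reasoning

eNum-sum : ∀ n → eNum n ≡ ∑[ i < suc n ] ascending (toℕ i) (n ∸ toℕ i)
eNum-sum zero = refl
eNum-sum (suc n) = begin
    suc n * eNum n + 1
  ≡⟨ cong (λ s → suc n * s + 1) (eNum-sum n) ⟩
    suc n * ∑[ i < suc n ] ascending (toℕ i) (n ∸ toℕ i) + 1
  ≡⟨ cong (_+ 1) (*-distribˡ-sum {suc n} (suc n) (λ i → ascending (toℕ i) (n ∸ toℕ i))) ⟩
    ∑[ i < suc n ] (suc n * ascending (toℕ i) (n ∸ toℕ i)) + 1
  ≡⟨ cong₂ _+_ (sum-cong-≗ {suc n} extend) (cong (ascending (suc n)) (sym (n∸n≡0 n))) ⟩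
    ∑[ i < suc n ] term (inject₁ i) + ascending (suc n) (suc n ∸ suc n)
  ≡⟨ cong (λ t → ∑[ i < suc n ] term (inject₁ i) + ascending t (suc n ∸ t)) (sym (toℕ-fromℕ (suc n))) ⟩
    ∑[ i < suc n ] term (inject₁ i) + term (fromℕ (suc n))
  ≡⟨ sym (sum-init-last term) ⟩
    ∑[ i < suc (suc n) ] term i
  ∎
  where
  open ≡-Reasoning
  term : Fin (suc (suc n)) → ℕ
  term i = ascending (toℕ i) (suc n ∸ toℕ i)
  extend : ∀ i → suc n * ascending (toℕ i) (n ∸ toℕ i) ≡ term (inject₁ i)
  extend i rewrite toℕ-inject₁ i | +-∸-assoc 1 (toℕ≤pred[n] i) =
    cong (λ s → suc s * ascending (toℕ i) (n ∸ toℕ i)) (sym (m+[n∸m]≡n (toℕ≤pred[n] i)))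

-- Termwise comparison: C(n, i) nⁿ⁻ⁱ n! ≤ (n! / i!) nⁿ, because C(n, i) i! ≤ nⁱ.
binomial-term-bound : ∀ n i → i ≤ n → (n C i) * n ^ (n ∸ i) * n ! ≤ ascending i (n ∸ i) * n ^ n
binomial-term-bound n i i≤n = *-cancelʳ-≤ _ _ (i !) {{i !≢0}} (begin
    (n C i) * n ^ (n ∸ i) * n ! * i !
  ≡⟨ regroup (n C i) (n ^ (n ∸ i)) (n !) (i !) ⟩
    (n C i) * i ! * n ^ (n ∸ i) * n !
  ≤⟨ *-monoˡ-≤ (n !) (*-monoˡ-≤ (n ^ (n ∸ i)) (C*!≤^ n i)) ⟩
    n ^ i * n ^ (n ∸ i) * n !
  ≡⟨ cong (_* n !) (sym (^-distribˡ-+-* n i (n ∸ i))) ⟩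
    n ^ (i + (n ∸ i)) * n !
  ≡⟨ cong (λ e → n ^ e * n !) (m+[n∸m]≡n i≤n) ⟩
    n ^ n * n !
  ≡⟨ cong (n ^ n *_) (sym (trans (ascending-! i (n ∸ i)) (cong _! (m+[n∸m]≡n i≤n)))) ⟩
    n ^ n * (ascending i (n ∸ i) * i !)
  ≡⟨ sym (*-assoc (n ^ n) (ascending i (n ∸ i)) (i !)) ⟩
    n ^ n * ascending i (n ∸ i) * i !
  ≡⟨ cong (_* i !) (*-comm (n ^ n) (ascending i (n ∸ i))) ⟩
    ascending i (n ∸ i) * n ^ n * i !
  ∎)
  where
  open ≤-Reasoning
  regroup : ∀ a b c d → a * b * c * d ≡ a * d * b * c
  regroup = solve-∀

-- (1 + 1/n)ⁿ ≤ ∑_{i ≤ n} 1/i!, cleared of denominators.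
exp-bound : ∀ n → suc n ^ n * n ! ≤ eNum n * n ^ n
exp-bound n = begin
    suc n ^ n * n !
  ≡⟨ cong (_* n !) (binomial-expansion n) ⟩
    (∑[ i < suc n ] ((n C toℕ i) * n ^ (n ∸ toℕ i))) * n !
  ≡⟨ *-distribʳ-sum {suc n} (n !) (λ i → (n C toℕ i) * n ^ (n ∸ toℕ i)) ⟩
    ∑[ i < suc n ] ((n C toℕ i) * n ^ (n ∸ toℕ i) * n !)
  ≤⟨ ∑-mono (λ i → binomial-term-bound n (toℕ i) (toℕ≤pred[n] i)) ⟩
    ∑[ i < suc n ] (ascending (toℕ i) (n ∸ toℕ i) * n ^ n)
  ≡⟨ sym (*-distribʳ-sum {suc n} (n ^ n) (λ i → ascending (toℕ i) (n ∸ toℕ i))) ⟩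
    (∑[ i < suc n ] ascending (toℕ i) (n ∸ toℕ i)) * n ^ n
  ≡⟨ cong (_* n ^ n) (sym (eNum-sum n)) ⟩
    eNum n * n ^ n
  ∎
  where open ≤-Reasoning

-- The local-lemma condition for event probability 1 / L and dependency degree d,
-- with x = 1/(c + 1):  1/L ≤ x (1 - x)ʳ, i.e. (c + 1)^(r + 1) ≤ L cʳ, for all r ≤ d.
LocalCondition : ℕ → ℕ → ℕ → Set
LocalCondition L c d = ∀ r → r ≤ d → suc c ^ suc r ≤ L * c ^ r

e-hypothesis : ∀ L k Δ′ → GeqETimes L k (suc Δ′) → ∀ n → suc (k * Δ′) * eNum n ≤ L * n !
e-hypothesis L k Δ′ L≥e n = +-cancelˡ-≤ (k * eNum n) _ _ (begin
    k * eNum n + suc (k * Δ′) * eNum n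
  ≡⟨ regroup k (k * Δ′) (eNum n) ⟩
    (k + k * Δ′ + 1) * eNum n
  ≡⟨ cong (λ a → (a + 1) * eNum n) (sym (*-suc k Δ′)) ⟩
    (k * suc Δ′ + 1) * eNum n
  ≤⟨ L≥e n ⟩
    L * n ! + k * eNum n
  ≡⟨ +-comm (L * n !) _ ⟩
    k * eNum n + L * n !
  ∎)
  where
  open ≤-Reasoning
  regroup : ∀ k d E → k * E + suc d * E ≡ (k + d + 1) * E
  regroup = solve-∀

-- With c = d + 1 the condition for r = d reads (d + 2)^(d + 1) ≤ L (d + 1)^d; it
-- follows from (1 + 1/(d + 1))^(d + 1) ≤ e.
power-bound : ∀ L d → suc d * eNum (suc d) ≤ L * suc d ! → suc (suc d) ^ suc d ≤ L * suc d ^ d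
power-bound L d hyp = *-cancelʳ-≤ _ _ (suc d * suc d !) {{m*n≢0 (suc d) (suc d !) {{_}} {{suc d !≢0}}}} (begin
    suc (suc d) ^ suc d * (suc d * suc d !)
  ≡⟨ regroup₁ (suc (suc d) ^ suc d) (suc d) (suc d !) ⟩
    suc d * (suc (suc d) ^ suc d * suc d !)
  ≤⟨ *-monoʳ-≤ (suc d) (exp-bound (suc d)) ⟩
    suc d * (eNum (suc d) * suc d ^ suc d)
  ≡⟨ sym (*-assoc (suc d) (eNum (suc d)) (suc d ^ suc d)) ⟩
    suc d * eNum (suc d) * suc d ^ suc d
  ≤⟨ *-monoˡ-≤ (suc d ^ suc d) hyp ⟩
    L * suc d ! * (suc d * suc d ^ d)
  ≡⟨ regroup₂ L (suc d !) (suc d) (suc d ^ d) ⟩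
    L * suc d ^ d * (suc d * suc d !)
  ∎)
  where
  open ≤-Reasoning
  regroup₁ : ∀ Q s F → Q * (s * F) ≡ s * (Q * F)
  regroup₁ = solve-∀
  regroup₂ : ∀ L F s P → L * F * (s * P) ≡ L * P * (s * F)
  regroup₂ = solve-∀

-- The condition for r = d implies it for every r ≤ d, as (c + 1) / c ≥ 1.
lower-exponent : ∀ L c d → 1 ≤ c → suc c ^ suc d ≤ L * c ^ d → LocalCondition L c d
lower-exponent L c d 1≤c top r r≤d =
  *-cancelʳ-≤ _ _ (c ^ (d ∸ r)) {{m^n≢0 c (d ∸ r) {{>-nonZero 1≤c}}}} (begin
    suc c ^ suc r * c ^ (d ∸ r)
  ≤⟨ *-monoʳ-≤ (suc c ^ suc r) (^-monoˡ-≤ (d ∸ r) (n≤1+n c)) ⟩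
    suc c ^ suc r * suc c ^ (d ∸ r)
  ≡⟨ sym (^-distribˡ-+-* (suc c) (suc r) (d ∸ r)) ⟩
    suc c ^ suc (r + (d ∸ r))
  ≡⟨ cong (λ e → suc c ^ suc e) (m+[n∸m]≡n r≤d) ⟩
    suc c ^ suc d
  ≤⟨ top ⟩
    L * c ^ d
  ≡⟨ cong (λ e → L * c ^ e) (sym (m+[n∸m]≡n r≤d)) ⟩
    L * c ^ (r + (d ∸ r))
  ≡⟨ cong (L *_) (^-distribˡ-+-* c r (d ∸ r)) ⟩
    L * (c ^ r * c ^ (d ∸ r))
  ≡⟨ sym (*-assoc L (c ^ r) (c ^ (d ∸ r))) ⟩
    L * c ^ r * c ^ (d ∸ r)
  ∎)
  where open ≤-Reasoning

-- The hypothesis of the theorem gives the local-lemma condition with c = d + 1,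
-- where d = k(Δ - 1) bounds the number of edges sharing a part with a given edge.
local-condition : ∀ L k Δ′ → GeqETimes L k (suc Δ′) → LocalCondition L (suc (k * Δ′)) (k * Δ′)
local-condition L k Δ′ L≥e =
  lower-exponent L (suc d) d (s≤s z≤n) (power-bound L d (e-hypothesis L k Δ′ L≥e (suc d)))
  where d = k * Δ′

module LocalLemma (m ℓ k c d : ℕ) {h : ℕ} (E : Fin h → List (Vertex m ℓ))
    (1≤ℓ : 1 ≤ ℓ) (1≤c : 1 ≤ c)
    (distinct : ∀ i → Unique (E i)) (size-k : ∀ i → length (E i) ≡ k)
    (condition : LocalCondition (ℓ ^ k) c d)
    (sparse : ∀ q → # (Events.neighbours m ℓ E q) ≤ d)
  where
  open Counting ℓ
  open Events m ℓ

  avoid : Fin h → Vec (Fin ℓ) m → ℕ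
  avoid i v = 1 ∸ hit (E i) v

  factor : Mask h → Fin h → Vec (Fin ℓ) m → ℕ
  factor M i v = if M i then avoid i v else 1

  avoids : Mask h → Vec (Fin ℓ) m → ℕ
  avoids M v = ∏ (λ i → factor M i v)

  N : Mask h → ℕ
  N M = count (avoids M)

  B : Mask h → Fin h → ℕ
  B M q = count (λ v → hit (E q) v * avoids M v)

  -- The inductive claim: Pr(E q | no edge of M) ≤ 1/(c + 1).
  Bounded : Mask h → Fin h → Set
  Bounded M q = suc c * B M q ≤ N M

  avoids-cong : ∀ {M M′} → (∀ i → M i ≡ M′ i) → ∀ v → avoids M v ≡ avoids M′ v
  avoids-cong M≡M′ v = ∏-cong {h} (λ i → cong (λ b → if b then avoid i v else 1) (M≡M′ i))

  avoids≤1 : ∀ M v → avoids M v ≤ 1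
  avoids≤1 M v = ∏≤1 (λ i → factor M i v) factor≤1
    where
    factor≤1 : ∀ i → factor M i v ≤ 1
    factor≤1 i with M i
    ... | true = m∸n≤m 1 (hit (E i) v)
    ... | false = ≤-refl

  avoids-split : ∀ M P v → avoids M v ≡ avoids (M ∩ P) v * avoids (M ∖ P) v
  avoids-split M P v = trans (∏-cong {h} (λ i → split (M i) (P i) (avoid i v)))
                             (∏-distrib-* (λ i → factor (M ∩ P) i v) (λ i → factor (M ∖ P) i v))
    where
    split : ∀ a b x → (if a then x else 1) ≡ (if a ∧ b then x else 1) * (if a ∧ not b then x else 1)
    split true true x = sym (*-identityʳ x)
    split true false x = sym (*-identityˡ x)
    split false b x = refl

  avoids-remove : ∀ M q → M q ≡ true → ∀ v → avoids M v ≡ avoid q v * avoids (M ─ q) v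
  avoids-remove M q Mq v =
    trans (avoids-split M (_== q) v) (cong (_* avoids (M ─ q) v) (∏-pick q (avoid q v) _ only-q))
    where
    only-q : ∀ i → factor (M ∩ (_== q)) i v ≡ (if i == q then avoid q v else 1)
    only-q i with i ≟ q
    ... | yes refl rewrite Mq = refl
    ... | no _ rewrite ∧-zeroʳ (M i) = refl

  avoids-independent : ∀ M p → (∀ i → M i ≡ true → touches (E i) p ≡ false) → IndependentOf (avoids M) p
  avoids-independent M p far v y = ∏-cong {h} same
    where
    same : ∀ i → factor M i (v [ p ]≔ y) ≡ factor M i v
    same i with M i in Mi
    ... | true = cong (1 ∸_) (hit-independent (E i) p (far i Mi) v y)
    ... | false = refl

  N-remove : ∀ M q → M q ≡ true → N (M ─ q) ≡ N M + B (M ─ q) q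
  N-remove M q Mq = trans (count-cong split) (count-+ (avoids M) (λ v → hit (E q) v * avoids (M ─ q) v))
    where
    split : ∀ v → avoids (M ─ q) v ≡ avoids M v + hit (E q) v * avoids (M ─ q) v
    split v = begin
        avoids (M ─ q) v
      ≡⟨ sym (*-identityˡ _) ⟩
        1 * avoids (M ─ q) v
      ≡⟨ cong (_* avoids (M ─ q) v) (sym (m∸n+n≡m (hit≤1 (E q) v))) ⟩
        (avoid q v + hit (E q) v) * avoids (M ─ q) v
      ≡⟨ *-distribʳ-+ (avoids (M ─ q) v) (avoid q v) _ ⟩
        avoid q v * avoids (M ─ q) v + hit (E q) v * avoids (M ─ q) v
      ≡⟨ cong (_+ hit (E q) v * avoids (M ─ q) v) (sym (avoids-remove M q Mq v)) ⟩
        avoids M v + hit (E q) v * avoids (M ─ q) v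
      ∎
      where open ≡-Reasoning

  remove-step : ∀ M q → M q ≡ true → Bounded (M ─ q) q → c * N (M ─ q) ≤ suc c * N M
  remove-step M q Mq bounded = +-cancelʳ-≤ (N (M ─ q)) _ _ (begin
      c * N (M ─ q) + N (M ─ q)
    ≡⟨ +-comm (c * N (M ─ q)) (N (M ─ q)) ⟩
      suc c * N (M ─ q)
    ≡⟨ cong (suc c *_) (N-remove M q Mq) ⟩
      suc c * (N M + B (M ─ q) q)
    ≡⟨ *-distribˡ-+ (suc c) (N M) (B (M ─ q) q) ⟩
      suc c * N M + suc c * B (M ─ q) q
    ≤⟨ +-monoʳ-≤ (suc c * N M) bounded ⟩
      suc c * N M + N (M ─ q)
    ∎)
    where open ≤-Reasoning

  SmallerBounded : Mask h → Set
  SmallerBounded M = ∀ M′ → # M′ < # M → ∀ q → Bounded M′ q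

  remove-many : ∀ M → SmallerBounded M → ∀ n A → # A ≡ n → A ⊆ M →
                c ^ n * N (M ∖ A) ≤ suc c ^ n * N M
  remove-many M smaller zero A #A≡0 A⊆M =
    ≤-reflexive (cong (1 *_) (count-cong (avoids-cong nothing-removed)))
    where
    nothing-removed : ∀ j → (M ∖ A) j ≡ M j
    nothing-removed j = trans (cong (λ b → M j ∧ not b) (#-empty A #A≡0 j)) (∧-identityʳ (M j))
  remove-many M smaller (suc n) A #A≡1+n A⊆M with #-witness A (subst (0 <_) (sym #A≡1+n) (s≤s z≤n))
  ... | q , Aq = begin
      c * c ^ n * N (M ∖ A)
    ≡⟨ cong (λ x → c * c ^ n * x) (count-cong (avoids-cong (∖-─ M A q Aq))) ⟩
      c * c ^ n * N ((M ─ q) ∖ (A ─ q))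
    ≡⟨ *-assoc c (c ^ n) _ ⟩
      c * (c ^ n * N ((M ─ q) ∖ (A ─ q)))
    ≤⟨ *-monoʳ-≤ c (remove-many (M ─ q) smaller′ n (A ─ q) #A─q (─-⊆ q A⊆M)) ⟩
      c * (suc c ^ n * N (M ─ q))
    ≡⟨ x*[y*z]≡y*[x*z] c (suc c ^ n) (N (M ─ q)) ⟩
      suc c ^ n * (c * N (M ─ q))
    ≤⟨ *-monoʳ-≤ (suc c ^ n) (remove-step M q Mq (smaller (M ─ q) #M─q<#M q)) ⟩
      suc c ^ n * (suc c * N M)
    ≡⟨ x*[y*z]≡y*[x*z] (suc c ^ n) (suc c) (N M) ⟩
      suc c * (suc c ^ n * N M)
    ≡⟨ sym (*-assoc (suc c) (suc c ^ n) (N M)) ⟩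
      suc c * suc c ^ n * N M
    ∎
    where
    open ≤-Reasoning
    x*[y*z]≡y*[x*z] : ∀ x y z → x * (y * z) ≡ y * (x * z)
    x*[y*z]≡y*[x*z] = solve-∀
    Mq = A⊆M q Aq
    #M─q<#M : # (M ─ q) < # M
    #M─q<#M = ≤-reflexive (sym (#-remove M q Mq))
    smaller′ : SmallerBounded (M ─ q)
    smaller′ M′ #M′<#M─q = smaller M′ (<-trans #M′<#M─q #M─q<#M)
    #A─q : # (A ─ q) ≡ n
    #A─q = suc-injective (trans (sym (#-remove A q Aq)) #A≡1+n)

  B-member : ∀ M q → M q ≡ true → B M q ≡ 0
  B-member M q Mq = count-zero _ never
    where
    never : ∀ v → hit (E q) v * avoids M v ≡ 0
    never v = begin
        hit (E q) v * avoids M v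
      ≡⟨ cong (hit (E q) v *_) (avoids-remove M q Mq v) ⟩
        hit (E q) v * (avoid q v * avoids (M ─ q) v)
      ≡⟨ sym (*-assoc (hit (E q) v) (avoid q v) _) ⟩
        hit (E q) v * (1 ∸ hit (E q) v) * avoids (M ─ q) v
      ≡⟨ cong (_* avoids (M ─ q) v) (bit*[1∸bit] (hit (E q) v) (hit≤1 (E q) v)) ⟩
        0
      ∎
      where
      open ≡-Reasoning
      bit*[1∸bit] : ∀ x → x ≤ 1 → x * (1 ∸ x) ≡ 0
      bit*[1∸bit] zero _ = refl
      bit*[1∸bit] (suc zero) _ = refl
      bit*[1∸bit] (suc (suc _)) (s≤s ())

  B-drop : ∀ M P q → B M q ≤ B (M ∖ P) q
  B-drop M P q = count-mono (λ v → *-monoʳ-≤ (hit (E q) v) (begin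
      avoids M v
    ≡⟨ avoids-split M P v ⟩
      avoids (M ∩ P) v * avoids (M ∖ P) v
    ≤⟨ *-monoˡ-≤ (avoids (M ∖ P) v) (avoids≤1 (M ∩ P) v) ⟩
      1 * avoids (M ∖ P) v
    ≡⟨ *-identityˡ _ ⟩
      avoids (M ∖ P) v
    ∎))
    where open ≤-Reasoning

  -- The edges meeting a part of E q (E q itself included).
  meets : Fin h → Mask h
  meets q i = shares (E i) (E q)

  -- Edges disjoint from the parts of E q are independent of E q: probability ℓ^(-k).
  B-far : ∀ M q → ℓ ^ k * B (M ∖ meets q) q ≤ N (M ∖ meets q)
  B-far M q = subst (λ n → ℓ ^ n * B (M ∖ meets q) q ≤ N (M ∖ meets q)) (size-k q)
                    (count-hit (E q) (distinct q) (avoids (M ∖ meets q)) independent)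
    where
    independent : ∀ x → x ∈ E q → IndependentOf (avoids (M ∖ meets q)) (proj₁ x)
    independent x x∈Eq = avoids-independent (M ∖ meets q) (proj₁ x) (λ i M∖meets →
      shares-false (E i) (E q) (not-true (proj₂ (∧-true (M i) _ M∖meets))) x x∈Eq)
      where
      not-true : ∀ {b} → not b ≡ true → b ≡ false
      not-true {false} _ = refl

  few-meeting : ∀ M q → M q ≡ false → # (M ∩ meets q) ≤ d
  few-meeting M q Mq = ≤-trans (#-mono neighbour) (sparse q)
    where
    neighbour : ∀ i → (M ∩ meets q) i ≡ true → neighbours E q i ≡ true
    neighbour i Mi∧meets with i ≟ q
    ... | yes refl = ⊥-elim (false≢true (trans (sym Mq) (proj₁ (∧-true (M q) _ Mi∧meets))))
      where
      false≢true : ¬ false ≡ true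
      false≢true ()
    ... | no _ = trans (∧-identityʳ _) (proj₂ (∧-true (M i) _ Mi∧meets))

  -- The induction step when E q ∉ M: split M into the at most d edges meeting
  -- E q, removed one at a time, and the rest M₂, which is independent of E q.
  bounded-nonmember : ∀ M q → SmallerBounded M → M q ≡ false → Bounded M q
  bounded-nonmember M q smaller Mq = *-cancelʳ-≤ (suc c * B M q) (N M) (ℓ ^ k * c ^ r) {{nonzero}} (begin
      suc c * B M q * (ℓ ^ k * c ^ r)
    ≤⟨ *-monoˡ-≤ (ℓ ^ k * c ^ r) (*-monoʳ-≤ (suc c) (B-drop M (meets q) q)) ⟩
      suc c * B M₂ q * (ℓ ^ k * c ^ r)
    ≡⟨ regroup (suc c) (B M₂ q) (ℓ ^ k) (c ^ r) ⟩
      suc c * (c ^ r * (ℓ ^ k * B M₂ q))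
    ≤⟨ *-monoʳ-≤ (suc c) (*-monoʳ-≤ (c ^ r) (B-far M q)) ⟩
      suc c * (c ^ r * N M₂)
    ≤⟨ *-monoʳ-≤ (suc c) remove-meeting ⟩
      suc c * (suc c ^ r * N M)
    ≡⟨ sym (*-assoc (suc c) (suc c ^ r) (N M)) ⟩
      suc c ^ suc r * N M
    ≤⟨ *-monoˡ-≤ (N M) (condition r (few-meeting M q Mq)) ⟩
      ℓ ^ k * c ^ r * N M
    ≡⟨ *-comm (ℓ ^ k * c ^ r) (N M) ⟩
      N M * (ℓ ^ k * c ^ r)
    ∎)
    where
    open ≤-Reasoning
    M₂ = M ∖ meets q
    r = # (M ∩ meets q)
    regroup : ∀ a x L b → a * x * (L * b) ≡ a * (b * (L * x))
    regroup = solve-∀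
    nonzero : NonZero (ℓ ^ k * c ^ r)
    nonzero = m*n≢0 (ℓ ^ k) (c ^ r) {{m^n≢0 ℓ k {{>-nonZero 1≤ℓ}}}} {{m^n≢0 c r {{>-nonZero 1≤c}}}}
    remove-meeting : c ^ r * N M₂ ≤ suc c ^ r * N M
    remove-meeting = subst (λ n → c ^ r * n ≤ suc c ^ r * N M) (count-cong (avoids-cong (∖-∩ M (meets q))))
                           (remove-many M smaller r (M ∩ meets q) refl (∩-⊆ M (meets q)))

  bounded-step : ∀ M q → SmallerBounded M → Bounded M q
  bounded-step M q smaller with M q in Mq
  ... | true = ≤-trans (≤-reflexive (trans (cong (suc c *_) (B-member M q Mq)) (*-zeroʳ (suc c)))) z≤n
  ... | false = bounded-nonmember M q smaller Mq

  smaller-bounded : ∀ s M → # M ≤ s → SmallerBounded M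
  smaller-bounded zero M #M≤0 M′ #M′<#M = ⊥-elim (n≮0 (≤-trans #M′<#M #M≤0))
  smaller-bounded (suc s) M #M≤1+s M′ #M′<#M q =
    bounded-step M′ q (smaller-bounded s M′ (≤-pred (≤-trans #M′<#M #M≤1+s)))

  everything : Mask h
  everything _ = true

  -- Removing all edges one at a time: N everything ≥ (c/(c+1))^h ℓ^m > 0.
  some-avoid-all : 0 < N everything
  some-avoid-all = proj₂ (positive-factors (suc c ^ # everything) _ (≤-trans all-transversals removed-all))
    where
    removed-all : c ^ # everything * N (everything ∖ everything) ≤ suc c ^ # everything * N everything
    removed-all = remove-many everything (smaller-bounded (# everything) everything ≤-refl)
                              (# everything) everything refl (λ _ e → e)
    all-transversals : 0 < c ^ # everything * N (everything ∖ everything)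
    all-transversals = *-mono-≤ (m^n>0 c {{>-nonZero 1≤c}} (# everything))
                                (subst (0 <_) (count-cong (λ v → sym (∏-ones (λ i → factor (everything ∖ everything) i v) (λ _ → refl))))
                                       (count-one-pos {m} 1≤ℓ))

  avoiding-transversal : Σ (Vec (Fin ℓ) m) λ v → ∀ i → hit (E i) v ≡ 0
  avoiding-transversal with count-pos (avoids everything) some-avoid-all
  ... | v , 0<avoids = v , λ i → bit-zero (hit (E i) v) (hit≤1 (E i) v) (∏-pos _ 0<avoids i)
    where
    bit-zero : ∀ x → x ≤ 1 → 0 < 1 ∸ x → x ≡ 0
    bit-zero zero _ _ = refl
    bit-zero (suc zero) _ ()
    bit-zero (suc (suc x)) (s≤s ()) _

module Degrees {m ℓ : ℕ} (H : Hypergraph m ℓ) where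
  open Events m ℓ

  E : Fin (length H) → List (Vertex m ℓ)
  E = L.lookup H

  touching : Fin m → Mask (length H)
  touching p i = touches (E i) p

  touches≤vertices : ∀ f p → 𝟙 (touches f p) ≤ ∑[ j < ℓ ] 𝟙 (does (any? ((p , j) ≟ᵥ_) f))
  touches≤vertices f p with touches f p in t
  ... | false = z≤n
  ... | true with touches-true f p t
  ...   | (.p , j) , pj∈f , refl =
    ≤-trans (≤-reflexive (cong 𝟙 (sym (dec-true (any? ((p , j) ≟ᵥ_) f) (lose pj∈f refl)))))
            (term≤∑ (λ j → 𝟙 (does (any? ((p , j) ≟ᵥ_) f))) j)

  touching≤partDegree : ∀ p → # (touching p) ≤ partDegree H p
  touching≤partDegree p = begin
      # (touching p)
    ≤⟨ ∑-mono (λ i → touches≤vertices (E i) p) ⟩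
      ∑[ i < length H ] ∑[ j < ℓ ] 𝟙 (does (any? ((p , j) ≟ᵥ_) (E i)))
    ≡⟨ ∑-comm (λ i j → 𝟙 (does (any? ((p , j) ≟ᵥ_) (E i)))) ⟩
      ∑[ j < ℓ ] # (λ i → does (any? ((p , j) ≟ᵥ_) (E i)))
    ≡⟨ sym (sum-cong-≗ {ℓ} (λ j → length-filter≡# (λ e → any? ((p , j) ≟ᵥ_) e) H)) ⟩
      ∑[ j < ℓ ] degree H (p , j)
    ≡⟨ sym (sum-allFin ℓ (λ j → degree H (p , j))) ⟩
      partDegree H p
    ∎
    where open ≤-Reasoning

  part-degree-pos : ∀ i x → x ∈ E i → 1 ≤ partDegree H (proj₁ x)
  part-degree-pos i x x∈Ei = ≤-trans (≤-trans (≤-reflexive (cong 𝟙 (sym (touches-∈ x∈Ei))))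
                                              (term≤∑ (λ i → 𝟙 (touching (proj₁ x) i)) i))
                                     (touching≤partDegree (proj₁ x))

  zero-degrees : (∀ p → partDegree H p ≤ 0) → ∀ i → E i ≡ []
  zero-degrees degrees i with E i in Ei
  ... | [] = refl
  ... | x ∷ _ = ⊥-elim (n≮0 (≤-trans (part-degree-pos i x (subst (x ∈_) (sym Ei) (here refl))) (degrees (proj₁ x))))

  neighbours-bound : ∀ k Δ′ → (∀ p → partDegree H p ≤ suc Δ′) →
                     ∀ q → length (E q) ≡ k → # (neighbours E q) ≤ k * Δ′
  neighbours-bound k Δ′ degrees q refl = sharing-bound (E q) (All.tabulate touches-∈)
    where
    other-touching : ∀ p → touches (E q) p ≡ true → # (touching p ─ q) ≤ Δ′
    other-touching p Eq-touches = ≤-pred (begin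
        suc (# (touching p ─ q))
      ≡⟨ sym (#-remove (touching p) q Eq-touches) ⟩
        # (touching p)
      ≤⟨ touching≤partDegree p ⟩
        partDegree H p
      ≤⟨ degrees p ⟩
        suc Δ′
      ∎)
      where open ≤-Reasoning
    sharing-bound : ∀ e → All (λ x → touches (E q) (proj₁ x) ≡ true) e →
                    # ((λ i → shares (E i) e) ─ q) ≤ length e * Δ′
    sharing-bound [] [] = ≤-reflexive (∑-zero (length H))
    sharing-bound ((p , j) ∷ e) (Eq-touches ∷ rest) = begin
        # ((λ i → touching p i ∨ shares (E i) e) ─ q)
      ≡⟨ #-cong (λ i → ∧-distribʳ-∨ (not (i == q)) (touching p i) (shares (E i) e)) ⟩
        # ((touching p ─ q) ∪ ((λ i → shares (E i) e) ─ q))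
      ≤⟨ #-union (touching p ─ q) _ ⟩
        # (touching p ─ q) + # ((λ i → shares (E i) e) ─ q)
      ≤⟨ +-mono-≤ (other-touching p Eq-touches) (sharing-bound e rest) ⟩
        Δ′ + length e * Δ′
      ∎
      where open ≤-Reasoning

edge-shape : ∀ {m ℓ k} {H : Hypergraph m ℓ} → IsUniform k H → ∀ i → Unique (L.lookup H i) × length (L.lookup H i) ≡ k
edge-shape (uniform , _) i = All.lookup uniform (∈-lookup i)

lemma2p1 : (k : ℕ) → 2 ≤ k → (m ℓ Δ : ℕ) → 1 ≤ ℓ → (H : Hypergraph m ℓ) →
    IsUniform k H →
    (∀ i → partDegree H i ≤ Δ) →
    GeqETimes (ℓ ^ k) k Δ →
    Σ (Transversal m ℓ) (λ t → Independent H t)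
-- Δ = 0: all edges are empty, contradicting k ≥ 2, so any transversal will do.
lemma2p1 k 2≤k m ℓ zero 1≤ℓ H uniform degrees _ =
  (λ _ → fromℕ< 1≤ℓ) , all-by-index H (λ i _ → n≮0 (subst (2 ≤_) (edge-size i) 2≤k))
  where
  open Degrees H
  edge-size : ∀ i → k ≡ 0
  edge-size i = trans (sym (proj₂ (edge-shape uniform i))) (cong length (zero-degrees degrees i))
-- Δ = Δ′ + 1: the local lemma with d = kΔ′ and c = d + 1 yields a transversal
-- containing no edge.
lemma2p1 k 2≤k m ℓ (suc Δ′) 1≤ℓ H uniform degrees L≥e =
  lookup v , all-by-index H (λ i contains → 0≢1 (trans (sym (v-avoids i)) (hit-contains (E i) v contains)))
  where
  open Degrees H
  open Events m ℓ
  open LocalLemma m ℓ k (suc (k * Δ′)) (k * Δ′) E 1≤ℓ (s≤s z≤n)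
                  (λ i → proj₁ (edge-shape uniform i)) (λ i → proj₂ (edge-shape uniform i))
                  (local-condition (ℓ ^ k) k Δ′ L≥e)
                  (λ q → neighbours-bound k Δ′ degrees q (proj₂ (edge-shape uniform q)))
  v = proj₁ avoiding-transversal
  v-avoids = proj₂ avoiding-transversal
  0≢1 : ¬ 0 ≡ 1
  0≢1 ()
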